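{- There exists a planar graph that admits a cycle signature which is triangulating but not acyclic.
   Context: For a graph $G$ with edge set $E$ and a fixed reference orientation, a directed cycle is a simple cycle traversed in one cyclic direction, viewed as a vector in $\{0,\pm1\}^E$. A cycle signature $\sigma$ chooses one of the two directed versions $\sigma(C)$ of every cycle $C$. It is acyclic if whenever $a_C\ge0$ are reals with $\sum_C a_C\sigma(C)=0$, all $a_C=0$. For a spanning tree (basis) $B$, let $\overrightarrow{B}$ be the arc set containing both directions of every edge of $B$ and, for each edge $e\notin B$, the direction of $e$ in $\sigma(C(B,e))$, where $C(B,e)$ is the fundamental cycle of $e$. $\sigma$ is triangulating if for every basis $B$, every directed cycle all of whose arcs lie in $\overrightarrow{B}$ belongs to $\sigma$. -}

module Defs where

open import Data.Nat using (ℕ; zero; suc; _<_)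
open import Data.Fin using (Fin; toℕ; inject₁; fromℕ)
open import Data.Fin.Subset using (Subset; _∈_; _∉_; _∪_; ⁅_⁆)
open import Data.Bool using (Bool; true; false; if_then_else_)
open import Data.Integer using (ℤ; +_; -[1+_])
import Data.Integer as ℤ
open import Data.Rational using (ℚ; 0ℚ; _/_)
import Data.Rational as ℚ
open import Data.Vec using (Vec; []; _∷_; _∷ʳ_; lookup; tabulate; map; zipWith; replicate)
open import Data.List using (List; foldr)
open import Data.List.Relation.Unary.All using (All)
open import Data.Product using (Σ; ∃; _×_; _,_; proj₁; proj₂)
open import Data.Sum using (_⊎_)
open import Relation.Binary.PropositionalEquality using (_≡_; _≢_)
open import Relation.Nullary using (¬_; does)
open import Data.Fin.Properties using () renaming (_≟_ to _≟ᶠ_)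
open import Level using (Level) renaming (suc to lsuc; zero to lzero)

-- Finite (multi)graphs with a fixed reference orientation.
-- Vertices Fin n, edges Fin m; edge e goes from tail e to head e.

record Graph : Set where
  field
    n    : ℕ
    m    : ℕ
    tail : Fin m → Fin n
    head : Fin m → Fin n

-- Planarity: an embedding in the plane by polygonal arcs with rational
-- coordinates.

Point : Set
Point = ℚ × ℚ

OnSeg : Point → Point → Point → Set
OnSeg (x₁ , x₂) (p₁ , p₂) (q₁ , q₂) =
  ∃ λ (t : ℚ) → (0ℚ ℚ.≤ t) × (t ℚ.≤ ℚ.1ℚ) ×
    (x₁ ≡ p₁ ℚ.+ t ℚ.* (q₁ ℚ.- p₁)) × (x₂ ≡ p₂ ℚ.+ t ℚ.* (q₂ ℚ.- p₂))

record Drawing (G : Graph) : Set where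
  open Graph G
  field
    pos    : Fin n → Point
    nbends : Fin m → ℕ
    bends  : (e : Fin m) → Vec Point (nbends e)

module _ {G : Graph} (D : Drawing G) where
  open Graph G
  open Drawing D

  pts : (e : Fin m) → Vec Point (suc (suc (nbends e)))
  pts e = pos (tail e) ∷ (bends e ∷ʳ pos (head e))

  segStart segEnd : (e : Fin m) → Fin (suc (nbends e)) → Point
  segStart e i = lookup (pts e) (inject₁ i)
  segEnd   e i = lookup (pts e) (Fin.suc i)

  OnEdge : Point → (e : Fin m) → Fin (suc (nbends e)) → Set
  OnEdge x e i = OnSeg x (segStart e i) (segEnd e i)

  record IsEmbedding : Set where
    field
      pos-injective : ∀ u v → pos u ≡ pos v → u ≡ v
      seg-nondegenerate : ∀ e i → segStart e i ≢ segEnd e i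
      -- each edge is a simple arc (a simple closed curve through its
      -- end vertex if e is a loop): two distinct segments of e only meet
      -- at their common endpoint when consecutive (or first/last for a loop)
      edge-simple : ∀ e (i j : Fin (suc (nbends e))) x → toℕ i < toℕ j →
        OnEdge x e i → OnEdge x e j →
          (toℕ j ≡ suc (toℕ i) × x ≡ segEnd e i)
        ⊎ (tail e ≡ head e × toℕ i ≡ 0 × toℕ j ≡ nbends e × x ≡ pos (tail e))
      edge-avoids-vertices : ∀ v e i → OnEdge (pos v) e i →
        v ≡ tail e ⊎ v ≡ head e
      edges-disjoint : ∀ e f → e ≢ f → ∀ i j x →
        OnEdge x e i → OnEdge x f j → ∃ λ v → x ≡ pos v

Planar : Graph → Set
Planar G = Σ (Drawing G) IsEmbedding


-- Directed (simple) cycles, as vectors in {0,±1}^E.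

sgn : Bool → ℤ
sgn true  = + 1
sgn false = -[1+ 0 ]

sumℤ : ∀ {k} → (Fin k → ℤ) → ℤ
sumℤ {zero}  f = + 0
sumℤ {suc k} f = f Fin.zero ℤ.+ sumℤ (λ i → f (Fin.suc i))

-- A directed simple cycle of length suc len: arcs (edge i, dir i),
-- dir true = traversed along the reference orientation.
record Arcs (G : Graph) : Set where
  field
    len  : ℕ
    edge : Fin (suc len) → Fin (Graph.m G)
    dir  : Fin (suc len) → Bool

module _ {G : Graph} (C : Arcs G) where
  open Graph G
  open Arcs C

  start end : Fin (suc len) → Fin n
  start i = if dir i then tail (edge i) else head (edge i)
  end   i = if dir i then head (edge i) else tail (edge i)

  vec : Vec ℤ m
  vec = tabulate λ e → sumℤ λ i → if does (edge i ≟ᶠ e) then sgn (dir i) else + 0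

  record IsSimpleCycle : Set where
    field
      consecutive : ∀ (i : Fin len) → end (inject₁ i) ≡ start (Fin.suc i)
      closing     : end (fromℕ len) ≡ start Fin.zero
      edges-distinct    : ∀ i j → edge i ≡ edge j → i ≡ j
      vertices-distinct : ∀ i j → start i ≡ start j → i ≡ j

IsDirCycle : (G : Graph) → Vec ℤ (Graph.m G) → Set
IsDirCycle G d = ∃ λ (C : Arcs G) → IsSimpleCycle C × vec C ≡ d

negV : ∀ {k} → Vec ℤ k → Vec ℤ k
negV = map (λ z → ℤ.- z)

-- Cycle signatures: σ picks exactly one of the two directed versions
-- d, -d of every cycle (σ is given as the set of chosen directed cycles).

record CycleSignature (G : Graph) : Set₁ where
  field
    σ       : Vec ℤ (Graph.m G) → Set
    σ-cycle : ∀ d → σ d → IsDirCycle G d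
    σ-total : ∀ d → IsDirCycle G d → σ d ⊎ σ (negV d)
    σ-excl  : ∀ d → IsDirCycle G d → ¬ (σ d × σ (negV d))

-- Acyclic: no nontrivial nonnegative combination of chosen directed
-- cycles vanishes. A (finite) family of coefficients a_C is given as a
-- list of pairs (a_C , σ(C)).

toℚ : ℤ → ℚ
toℚ z = z / 1

lincomb : ∀ {k} → List (ℚ × Vec ℤ k) → Vec ℚ k
lincomb = foldr (λ p acc → zipWith ℚ._+_ (map (λ z → proj₁ p ℚ.* toℚ z) (proj₂ p)) acc)
                (replicate _ 0ℚ)

Acyclic : (G : Graph) → CycleSignature G → Set
Acyclic G S = ∀ (L : List (ℚ × Vec ℤ (Graph.m G))) →
  All (λ p → CycleSignature.σ S (proj₂ p) × 0ℚ ℚ.≤ proj₁ p) L →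
  lincomb L ≡ replicate _ 0ℚ →
  All (λ p → proj₁ p ≡ 0ℚ) L

-- Bases of the graphic matroid (spanning forests; spanning trees for
-- connected G): maximal edge sets containing no cycle.

SupportIn : ∀ {k} → Vec ℤ k → (Fin k → Set) → Set
SupportIn d P = ∀ e → lookup d e ≢ + 0 → P e

Independent : (G : Graph) → Subset (Graph.m G) → Set
Independent G B = ∀ d → IsDirCycle G d → ¬ SupportIn d (λ e → e ∈ B)

IsBasis : (G : Graph) → Subset (Graph.m G) → Set
IsBasis G B = Independent G B × (∀ e → e ∉ B → ¬ Independent G (B ∪ ⁅ e ⁆))

-- The arc (e, dir) lies in B⃗: e ∈ B (both directions), or e ∉ B and
-- dir is the direction of e in σ(C(B,e)); here C(B,e) is the unique
-- cycle in B ∪ {e} (the fundamental cycle), and σ(C(B,e)) is the chosen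
-- directed cycle supported in B ∪ {e} and using e.
InArcs : (G : Graph) → CycleSignature G → Subset (Graph.m G) →
         Fin (Graph.m G) → Bool → Set
InArcs G S B e s = e ∈ B ⊎
  (e ∉ B × ∃ λ d → CycleSignature.σ S d ×
     SupportIn d (λ f → f ∈ B ⊎ f ≡ e) × lookup d e ≡ sgn s)

Triangulating : (G : Graph) → CycleSignature G → Set
Triangulating G S = ∀ B → IsBasis G B → ∀ d → IsDirCycle G d →
  (∀ e → (lookup d e ≡ sgn true → InArcs G S B e true) ×
         (lookup d e ≡ sgn false → InArcs G S B e false)) →
  CycleSignature.σ S d

{-# OPTIONS --safe #-}
-- The witness is K₄ with the two opposite edges 01 and 23 doubled. Its four
-- Hamiltonian cycles can be oriented so that they sum to zero, which rules out
-- acyclicity, and orienting the other fifteen cycles suitably makes the signature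
-- triangulating. Everything is then a finite check. Planarity is certified by a
-- polyline drawing with rational bend points in which the bounding boxes of any two
-- segments meet at most in a point where the segments are allowed to meet. Since the
-- graph has four vertices, every directed cycle is a closed trail of at most four
-- arcs, so a search over such trails shows that the nineteen chosen cycles cover all
-- directed cycles up to reversal. A directed cycle that the signature does not
-- choose is therefore the reversal of a chosen one, so for triangulation it suffices
-- to check, over all 256 edge sets, that no basis B has a reversed chosen cycle with
-- all of its arcs in B⃗.
module Submission where

open import Defs
open import Data.Nat as ℕ using (ℕ; zero; suc)
open import Data.Fin using (Fin; zero; suc; #_; toℕ; inject₁; fromℕ)
open import Data.Fin.Properties using (all?; any?; injective⇒≤) renaming (_≟_ to _≟ᶠ_)
open import Data.Fin.Subset using (Subset; _∪_; ⁅_⁆)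
open import Data.Fin.Subset.Properties using (_∈?_; anySubset?)
open import Data.Bool using (Bool; true; false; if_then_else_)
open import Data.Integer as ℤ using (ℤ; +_; -1ℤ)
open import Data.Integer.Properties using (neg-involutive)
open import Data.Rational using (ℚ; 0ℚ; 1ℚ; _+_; _*_; -_; _-_; _/_; _≤_; _<_; _⊓_; _⊔_; nonNegative)
open import Data.Rational.Properties
  using (_≟_; _≤?_; _<?_; ≤-trans; ≤-antisym; <-irrefl; ≤-<-trans; +-mono-≤; +-monoˡ-≤; +-inverseʳ;
         *-monoˡ-≤-nonNeg; p⊓q≤p; p⊓q≤q; p≤p⊔q; p≤q⊔p; ⊓-glb; ⊔-lub)
open import Data.Rational.Solver using (module +-*-Solver)
open import Data.List as List using (List; []; _∷_)
open import Data.List.NonEmpty using (List⁺; _∷_)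
open import Data.List.Relation.Unary.All using (All; []; _∷_)
open import Data.List.Relation.Unary.Any using (here)
open import Data.List.Relation.Unary.All.Properties using (Any¬⇒¬All)
open import Data.Vec as Vec using (Vec; []; _∷_; lookup)
open import Data.Vec.Properties using (tabulate-cong; lookup-map; map-∘; map-cong; map-id; ≡-dec)
open import Data.Vec.Functional using (Vector) renaming (_∷_ to _∷ᶠ_)
open import Data.Product using (Σ; ∃; _×_; _,_; proj₁; proj₂)
open import Data.Product.Properties using () renaming (≡-dec to ×-≡-dec)
open import Data.Sum using (_⊎_; inj₁; inj₂)
open import Function using (_∘_)
open import Level using (0ℓ)
open import Relation.Binary.PropositionalEquality
  using (_≡_; _≢_; _≗_; refl; sym; trans; cong; cong₂; subst; subst₂)
open import Relation.Nullary using (¬_; Dec; does; map′; contradiction; _×-dec_; _⊎-dec_; _→-dec_; ¬?)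
open import Relation.Nullary.Decidable using (from-yes; from-no)
open import Relation.Unary using (Pred; Decidable)

lerp-as-convex : ∀ p q t → p + t * (q - p) ≡ (1ℚ - t) * p + t * q
lerp-as-convex = solve 3 (λ p q t → p :+ t :* (q :- p) := (con 1ℚ :- t) :* p :+ t :* q) refl
  where open +-*-Solver

convex-idem : ∀ m t → (1ℚ - t) * m + t * m ≡ m
convex-idem = solve 2 (λ m t → (con 1ℚ :- t) :* m :+ t :* m := m) refl
  where open +-*-Solver

convex-mono-≤ : ∀ {a b p q t} → 0ℚ ≤ t → t ≤ 1ℚ → a ≤ p → b ≤ q →
                (1ℚ - t) * a + t * b ≤ (1ℚ - t) * p + t * q
convex-mono-≤ {t = t} 0≤t t≤1 a≤p b≤q =
  +-mono-≤ (*-monoˡ-≤-nonNeg (1ℚ - t) {{nonNegative 0≤1-t}} a≤p)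
           (*-monoˡ-≤-nonNeg t {{nonNegative 0≤t}} b≤q)
  where
  0≤1-t : 0ℚ ≤ 1ℚ - t
  0≤1-t = subst (_≤ 1ℚ - t) (+-inverseʳ t) (+-monoˡ-≤ (- t) t≤1)

record Interval : Set where
  constructor [_,_]
  field
    lo hi : ℚ
open Interval

infix 4 _∈ᴵ_ _∈ᴵ?_
_∈ᴵ_ : ℚ → Interval → Set
x ∈ᴵ [ a , b ] = a ≤ x × x ≤ b

_∈ᴵ?_ : ∀ x I → Dec (x ∈ᴵ I)
x ∈ᴵ? [ a , b ] = (a ≤? x) ×-dec (x ≤? b)

hull : ℚ → ℚ → Interval
hull a b = [ a ⊓ b , a ⊔ b ]

_∩ᴵ_ : Interval → Interval → Interval
[ a , b ] ∩ᴵ [ c , d ] = [ a ⊔ c , b ⊓ d ]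

lerp-∈-hull : ∀ p q t → 0ℚ ≤ t → t ≤ 1ℚ → p + t * (q - p) ∈ᴵ hull p q
lerp-∈-hull p q t 0≤t t≤1 = lower , upper
  where
  lower : p ⊓ q ≤ p + t * (q - p)
  lower = subst₂ _≤_ (convex-idem (p ⊓ q) t) (sym (lerp-as-convex p q t))
                 (convex-mono-≤ 0≤t t≤1 (p⊓q≤p p q) (p⊓q≤q p q))
  upper : p + t * (q - p) ≤ p ⊔ q
  upper = subst₂ _≤_ (sym (lerp-as-convex p q t)) (convex-idem (p ⊔ q) t)
                 (convex-mono-≤ 0≤t t≤1 (p≤p⊔q p q) (p≤q⊔p p q))

∈-∩ᴵ : ∀ {x} I J → x ∈ᴵ I → x ∈ᴵ J → x ∈ᴵ (I ∩ᴵ J)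
∈-∩ᴵ [ a , b ] [ c , d ] (a≤x , x≤b) (c≤x , x≤d) = ⊔-lub a≤x c≤x , ⊓-glb x≤b x≤d

EmptyInterval : Interval → Set
EmptyInterval I = hi I < lo I

∉-empty : ∀ {x} I → EmptyInterval I → ¬ x ∈ᴵ I
∉-empty [ a , b ] b<a (a≤x , x≤b) = <-irrefl refl (≤-<-trans (≤-trans a≤x x≤b) b<a)

∈-degenerate : ∀ {x} I → lo I ≡ hi I → x ∈ᴵ I → x ≡ lo I
∈-degenerate [ a , b ] a≡b (a≤x , x≤b) = ≤-antisym (subst (_ ≤_) (sym a≡b) x≤b) a≤x

Box : Set
Box = Interval × Interval

infix 4 _∈ᴮ_ _∈ᴮ?_
_∈ᴮ_ : Point → Box → Set
(x₁ , x₂) ∈ᴮ (I , J) = x₁ ∈ᴵ I × x₂ ∈ᴵ J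

_∈ᴮ?_ : ∀ x K → Dec (x ∈ᴮ K)
(x₁ , x₂) ∈ᴮ? (I , J) = (x₁ ∈ᴵ? I) ×-dec (x₂ ∈ᴵ? J)

segBox : Point → Point → Box
segBox (p₁ , p₂) (q₁ , q₂) = hull p₁ q₁ , hull p₂ q₂

_∩ᴮ_ : Box → Box → Box
(I , J) ∩ᴮ (I' , J') = I ∩ᴵ I' , J ∩ᴵ J'

OnSeg⇒∈segBox : ∀ x p q → OnSeg x p q → x ∈ᴮ segBox p q
OnSeg⇒∈segBox _ (p₁ , p₂) (q₁ , q₂) (t , 0≤t , t≤1 , refl , refl) =
  lerp-∈-hull p₁ q₁ t 0≤t t≤1 , lerp-∈-hull p₂ q₂ t 0≤t t≤1

∈-∩ᴮ : ∀ {x} K L → x ∈ᴮ K → x ∈ᴮ L → x ∈ᴮ (K ∩ᴮ L)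
∈-∩ᴮ (I , J) (I' , J') (x₁∈I , x₂∈J) (x₁∈I' , x₂∈J') = ∈-∩ᴵ I I' x₁∈I x₁∈I' , ∈-∩ᴵ J J' x₂∈J x₂∈J'

EmptyOrPoint : Pred Point 0ℓ → Box → Set
EmptyOrPoint Q (I , J) = EmptyInterval I ⊎ EmptyInterval J ⊎ (lo I ≡ hi I × lo J ≡ hi J × Q (lo I , lo J))

emptyOrPoint? : ∀ {Q} → Decidable Q → Decidable (EmptyOrPoint Q)
emptyOrPoint? Q? (I , J) =
  (hi I <? lo I) ⊎-dec (hi J <? lo J) ⊎-dec ((lo I ≟ hi I) ×-dec (lo J ≟ hi J) ×-dec Q? (lo I , lo J))

emptyOrPoint⇒ : ∀ {Q x} K → EmptyOrPoint Q K → x ∈ᴮ K → Q x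
emptyOrPoint⇒ (I , J) (inj₁ I=∅) (x₁∈I , _) = contradiction x₁∈I (∉-empty I I=∅)
emptyOrPoint⇒ (I , J) (inj₂ (inj₁ J=∅)) (_ , x₂∈J) = contradiction x₂∈J (∉-empty J J=∅)
emptyOrPoint⇒ {Q} (I , J) (inj₂ (inj₂ (I-pt , J-pt , q))) (x₁∈I , x₂∈J) =
  subst Q (sym (cong₂ _,_ (∈-degenerate I I-pt x₁∈I) (∈-degenerate J J-pt x₂∈J))) q

segments-meet-within : ∀ {Q} p p' r r' → EmptyOrPoint Q (segBox p p' ∩ᴮ segBox r r') →
                       ∀ x → OnSeg x p p' → OnSeg x r r' → Q x
segments-meet-within p p' r r' cert x x∈pp' x∈rr' =
  emptyOrPoint⇒ (segBox p p' ∩ᴮ segBox r r') cert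
    (∈-∩ᴮ (segBox p p') (segBox r r') (OnSeg⇒∈segBox x p p' x∈pp') (OnSeg⇒∈segBox x r r' x∈rr'))


_≟ᴾ_ : (p q : Point) → Dec (p ≡ q)
_≟ᴾ_ = ×-≡-dec _≟_ _≟_

module _ {G : Graph} (D : Drawing G) where
  open Graph G
  open Drawing D

  segBoxOf : (e : Fin m) → Fin (suc (nbends e)) → Box
  segBoxOf e i = segBox (segStart D e i) (segEnd D e i)

  record BoxCertified : Set where
    field
      pos-injective : ∀ u v → pos u ≡ pos v → u ≡ v
      seg-nondegenerate : ∀ e i → segStart D e i ≢ segEnd D e i
      segments-of-edge : ∀ e (i j : Fin (suc (nbends e))) → toℕ i ℕ.< toℕ j →
        EmptyOrPoint (λ x → toℕ j ≡ suc (toℕ i) × x ≡ segEnd D e i) (segBoxOf e i ∩ᴮ segBoxOf e j)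
      vertex-off-edge : ∀ v e → (v ≡ tail e ⊎ v ≡ head e) ⊎ (∀ i → ¬ pos v ∈ᴮ segBoxOf e i)
      segments-of-distinct-edges : ∀ e f → e ≢ f → ∀ i j →
        EmptyOrPoint (λ x → ∃ λ v → x ≡ pos v) (segBoxOf e i ∩ᴮ segBoxOf f j)

  boxCertified? : Dec BoxCertified
  boxCertified? =
    map′ (λ (inj , nd , sim , off , dis) → record
           { pos-injective = inj ; seg-nondegenerate = nd ; segments-of-edge = sim
           ; vertex-off-edge = off ; segments-of-distinct-edges = dis })
         (λ c → let open BoxCertified c in
           pos-injective , seg-nondegenerate , segments-of-edge , vertex-off-edge , segments-of-distinct-edges)
         (all? (λ u → all? λ v → (pos u ≟ᴾ pos v) →-dec (u ≟ᶠ v))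
         ×-dec all? (λ e → all? λ i → ¬? (segStart D e i ≟ᴾ segEnd D e i))
         ×-dec all? (λ e → all? λ i → all? λ j → (toℕ i ℕ.<? toℕ j) →-dec
                 emptyOrPoint? (λ x → (toℕ j ℕ.≟ suc (toℕ i)) ×-dec (x ≟ᴾ segEnd D e i)) _)
         ×-dec all? (λ v → all? λ e → ((v ≟ᶠ tail e) ⊎-dec (v ≟ᶠ head e)) ⊎-dec
                 all? λ i → ¬? (pos v ∈ᴮ? segBoxOf e i))
         ×-dec all? (λ e → all? λ f → ¬? (e ≟ᶠ f) →-dec all? λ i → all? λ j →
                 emptyOrPoint? (λ x → any? λ v → x ≟ᴾ pos v) _))

  edges-meet-within : ∀ {Q} e i f j → EmptyOrPoint Q (segBoxOf e i ∩ᴮ segBoxOf f j) →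
                      ∀ x → OnEdge D x e i → OnEdge D x f j → Q x
  edges-meet-within e i f j =
    segments-meet-within (segStart D e i) (segEnd D e i) (segStart D f j) (segEnd D f j)

  boxCertified⇒isEmbedding : BoxCertified → IsEmbedding D
  boxCertified⇒isEmbedding c = record
    { pos-injective = pos-injective
    ; seg-nondegenerate = seg-nondegenerate
    ; edge-simple = λ e i j x i<j x∈i x∈j →
        inj₁ (edges-meet-within e i e j (segments-of-edge e i j i<j) x x∈i x∈j)
    ; edge-avoids-vertices = edge-avoids-vertices
    ; edges-disjoint = λ e f e≢f i j x x∈i x∈j →
        edges-meet-within e i f j (segments-of-distinct-edges e f e≢f i j) x x∈i x∈j
    }
    where
    open BoxCertified c
    edge-avoids-vertices : ∀ v e i → OnEdge D (pos v) e i → v ≡ tail e ⊎ v ≡ head e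
    edge-avoids-vertices v e i v∈i with vertex-off-edge v e
    ... | inj₁ endpoint = endpoint
    ... | inj₂ off = contradiction (OnSeg⇒∈segBox (pos v) (segStart D e i) (segEnd D e i) v∈i) (off i)

injective? : ∀ {a b} (f : Fin a → Fin b) → Dec (∀ i j → f i ≡ f j → i ≡ j)
injective? f = all? λ i → all? λ j → (f i ≟ᶠ f j) →-dec (i ≟ᶠ j)

module _ {A : Set} (R : A → A → Set) where

  Chain : ∀ {L} → Vector A (suc L) → Set
  Chain {L} w = ∀ (i : Fin L) → R (w (inject₁ i)) (w (suc i))

  -- Chains are enumerated by extending them at the front one adjacent element at a
  -- time, so only chains (not all sequences) are ever visited.
  ∀-chain? : (∀ {P : Pred A 0ℓ} → Decidable P → Dec (∀ a → P a)) → (∀ a b → Dec (R a b)) →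
             ∀ L {P : Pred (Vector A (suc L)) 0ℓ} → (∀ {w w'} → w ≗ w' → P w → P w') →
             Decidable P → Dec (∀ w → Chain w → P w)
  ∀-chain? ∀? R? zero resp P? =
    map′ (λ all w _ → resp (λ { zero → refl }) (all (w zero)))
         (λ all a → all (λ _ → a) (λ ()))
         (∀? (λ a → P? (λ _ → a)))
  ∀-chain? ∀? R? (suc L) {P} resp P? =
    map′ (λ all w c → resp (λ { zero → refl ; (suc i) → refl }) (all (w ∘ suc) (c ∘ suc) (w zero) (c zero)))
         (λ all g c a r → all (a ∷ᶠ g) λ { zero → r ; (suc i) → c i })
         (∀-chain? ∀? R? L resp-extend (λ g → ∀? λ a → R? a (g zero) →-dec P? (a ∷ᶠ g)))
    where
    Extend : Pred (Vector A (suc L)) 0ℓ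
    Extend g = ∀ a → R a (g zero) → P (a ∷ᶠ g)
    resp-extend : ∀ {g g'} → g ≗ g' → Extend g → Extend g'
    resp-extend g≗g' ext a r =
      resp (λ { zero → refl ; (suc i) → g≗g' i }) (ext a (subst (R a) (sym (g≗g' zero)) r))

sumℤ-cong : ∀ {k} {f g : Fin k → ℤ} → f ≗ g → sumℤ f ≡ sumℤ g
sumℤ-cong {zero} f≗g = refl
sumℤ-cong {suc k} f≗g = cong₂ ℤ._+_ (f≗g zero) (sumℤ-cong (f≗g ∘ suc))

module Trails (G : Graph) where
  open Graph G

  Arc : Set
  Arc = Fin m × Bool

  infix 9 _⁺ _⁻
  _⁺ _⁻ : Fin m → Arc
  e ⁺ = e , true
  e ⁻ = e , false

  src tgt : Arc → Fin n
  src (e , s) = if s then tail e else head e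
  tgt (e , s) = if s then head e else tail e

  Adjacent : Arc → Arc → Set
  Adjacent a b = tgt a ≡ src b

  ∀-arc? : ∀ {P : Pred Arc 0ℓ} → Decidable P → Dec (∀ a → P a)
  ∀-arc? P? = map′ (λ all → λ { (e , true) → proj₁ (all e) ; (e , false) → proj₂ (all e) })
                   (λ all e → all (e ⁺) , all (e ⁻))
                   (all? λ e → P? (e ⁺) ×-dec P? (e ⁻))

  arcsOf : ∀ {L} → Vector Arc (suc L) → Arcs G
  arcsOf {L} w = record { len = L ; edge = proj₁ ∘ w ; dir = proj₂ ∘ w }

  vec-cong : ∀ {L} {w w' : Vector Arc (suc L)} → w ≗ w' → vec (arcsOf w) ≡ vec (arcsOf w')
  vec-cong w≗w' = tabulate-cong λ e →
    sumℤ-cong λ i → cong (λ (f , s) → if does (f ≟ᶠ e) then sgn s else + 0) (w≗w' i)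

  Closes : ∀ {L} → Vector Arc (suc L) → Set
  Closes {L} w = tgt (w (fromℕ L)) ≡ src (w zero)

  EdgeInjective : ∀ {L} → Vector Arc (suc L) → Set
  EdgeInjective w = ∀ i j → proj₁ (w i) ≡ proj₁ (w j) → i ≡ j

  ClosedTrailsSatisfy : Pred (Vec ℤ m) 0ℓ → ℕ → Set
  ClosedTrailsSatisfy Q L =
    ∀ (w : Vector Arc (suc L)) → Chain Adjacent w → Closes w → EdgeInjective w → Q (vec (arcsOf w))

  closedTrailsSatisfy? : ∀ {Q} → Decidable Q → Decidable (ClosedTrailsSatisfy Q)
  closedTrailsSatisfy? {Q} Q? L =
    ∀-chain? Adjacent ∀-arc? (λ a b → tgt a ≟ᶠ src b) L resp
      (λ w → (tgt (w (fromℕ L)) ≟ᶠ src (w zero)) →-dec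
             (injective? (proj₁ ∘ w) →-dec Q? (vec (arcsOf w))))
    where
    resp : ∀ {w w'} → w ≗ w' → (Closes w → EdgeInjective w → Q (vec (arcsOf w))) →
                               Closes w' → EdgeInjective w' → Q (vec (arcsOf w'))
    resp {w} {w'} w≗w' q closes' inj' = subst Q (vec-cong w≗w') (q closes inj)
      where
      closes : Closes w
      closes = subst₂ _≡_ (cong tgt (sym (w≗w' (fromℕ L)))) (cong src (sym (w≗w' zero))) closes'
      inj : EdgeInjective w
      inj i j eq = inj' i j (trans (cong proj₁ (sym (w≗w' i))) (trans eq (cong proj₁ (w≗w' j))))

  isSimpleCycle? : (C : Arcs G) → Dec (IsSimpleCycle C)
  isSimpleCycle? C =
    map′ (λ (cons , clos , edges , verts) → record
           { consecutive = cons ; closing = clos ; edges-distinct = edges ; vertices-distinct = verts })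
         (λ sc → let open IsSimpleCycle sc in consecutive , closing , edges-distinct , vertices-distinct)
         (all? (λ i → end C (inject₁ i) ≟ᶠ start C (suc i)) ×-dec (end C (fromℕ len) ≟ᶠ start C zero)
           ×-dec injective? edge ×-dec injective? (start C))
    where open Arcs C

  simpleCycle-len< : (C : Arcs G) → IsSimpleCycle C → Arcs.len C ℕ.< n
  simpleCycle-len< C sc = injective⇒≤ {f = start C} (λ {i} {j} → IsSimpleCycle.vertices-distinct sc i j)

  closedTrails⇒dirCycles : ∀ {Q} → (∀ {L} → L ℕ.< n → ClosedTrailsSatisfy Q L) →
                           ∀ d → IsDirCycle G d → Q d
  closedTrails⇒dirCycles short d (C , sc , refl) =
    short (simpleCycle-len< C sc) arcs consecutive closing edges-distinct
    where
    open Arcs C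
    open IsSimpleCycle sc
    arcs : Vector Arc (suc len)
    arcs i = edge i , dir i

negV-involutive : ∀ {k} (d : Vec ℤ k) → negV (negV d) ≡ d
negV-involutive d = trans (sym (map-∘ ℤ.-_ ℤ.-_ d)) (trans (map-cong neg-involutive d) (map-id d))

supportIn? : ∀ {k} {P : Pred (Fin k) 0ℓ} → Decidable P → ∀ d → Dec (SupportIn d P)
supportIn? P? d = all? λ e → ¬? (lookup d e ℤ.≟ + 0) →-dec P? e

supportIn-negV : ∀ {k} {P : Pred (Fin k) 0ℓ} d → SupportIn d P → SupportIn (negV d) P
supportIn-negV d supp e -dₑ≢0 = supp e λ dₑ≡0 → -dₑ≢0 (trans (lookup-map e ℤ.-_ d) (cong ℤ.-_ dₑ≡0))

module RepresentativeSignature (G : Graph) {k} (rep : Fin k → Vec ℤ (Graph.m G)) where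
  open Graph G

  Represented : Pred (Vec ℤ m) 0ℓ
  Represented d = ∃ λ i → rep i ≡ d

  Signed : Pred (Vec ℤ m) 0ℓ
  Signed d = Represented d ⊎ Represented (negV d)

  signed? : Decidable Signed
  signed? d = represented? d ⊎-dec represented? (negV d)
    where
    represented? : Decidable Represented
    represented? d = any? λ i → ≡-dec ℤ._≟_ (rep i) d

  module Transversal (rep-cycle : ∀ i → IsDirCycle G (rep i))
                     (rep-no-reversal : ∀ i j → rep j ≢ negV (rep i))
                     (signed : ∀ d → IsDirCycle G d → Signed d) where

    signature : CycleSignature G
    signature = record
      { σ = Represented
      ; σ-cycle = λ { _ (i , refl) → rep-cycle i }
      ; σ-total = signed
      ; σ-excl = λ { _ _ ((i , refl) , (j , repⱼ≡-repᵢ)) → rep-no-reversal i j repⱼ≡-repᵢ }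
      }

    supported-representative : ∀ {P : Pred (Fin m) 0ℓ} d → IsDirCycle G d → SupportIn d P →
                               ∃ λ i → SupportIn (rep i) P
    supported-representative d cyc supp with signed d cyc
    ... | inj₁ (i , refl) = i , supp
    ... | inj₂ (i , repᵢ≡-d) = i , subst (λ v → SupportIn v _) (sym repᵢ≡-d) (supportIn-negV d supp)

    independent? : Decidable (Independent G)
    independent? B =
      map′ (λ none d cyc supp → let i , suppᵢ = supported-representative d cyc supp in none i suppᵢ)
           (λ indep i → indep (rep i) (rep-cycle i))
           (all? λ i → ¬? (supportIn? (_∈? B) (rep i)))

    isBasis? : Decidable (IsBasis G)
    isBasis? B = independent? B ×-dec all? λ e → ¬? (e ∈? B) →-dec ¬? (independent? (B ∪ ⁅ e ⁆))

    inArcs? : ∀ B e s → Dec (InArcs G signature B e s)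
    inArcs? B e s = (e ∈? B) ⊎-dec (¬? (e ∈? B) ×-dec
      map′ (λ (i , supp , repᵢₑ) → rep i , (i , refl) , supp , repᵢₑ)
           (λ { (_ , (i , refl) , supp , repᵢₑ) → i , supp , repᵢₑ })
           (any? λ i → supportIn? (λ f → (f ∈? B) ⊎-dec (f ≟ᶠ e)) (rep i) ×-dec (lookup (rep i) e ℤ.≟ sgn s)))

    ArcsIn : Subset m → Pred (Vec ℤ m) 0ℓ
    ArcsIn B d = ∀ e → (lookup d e ≡ sgn true → InArcs G signature B e true) ×
                       (lookup d e ≡ sgn false → InArcs G signature B e false)

    arcsIn? : ∀ B → Decidable (ArcsIn B)
    arcsIn? B d = all? λ e → ((lookup d e ℤ.≟ sgn true) →-dec inArcs? B e true) ×-dec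
                             ((lookup d e ℤ.≟ sgn false) →-dec inArcs? B e false)

    ReversedRepresentativeInBasis : Set
    ReversedRepresentativeInBasis = ∃ λ B → IsBasis G B × ∃ λ i → ArcsIn B (negV (rep i))

    reversedRepresentativeInBasis? : Dec ReversedRepresentativeInBasis
    reversedRepresentativeInBasis? =
      anySubset? λ B → isBasis? B ×-dec any? λ i → arcsIn? B (negV (rep i))

    triangulating : ¬ ReversedRepresentativeInBasis → Triangulating G signature
    triangulating none B basis d cyc arcs with signed d cyc
    ... | inj₁ chosen = chosen
    ... | inj₂ (i , repᵢ≡-d) =
      contradiction (B , basis , i , subst (ArcsIn B) (sym -repᵢ≡d) arcs) none
      where
      -repᵢ≡d : negV (rep i) ≡ d
      -repᵢ≡d = trans (cong negV repᵢ≡-d) (negV-involutive d)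

graph : Graph
graph = record
  { n = 4 ; m = 8
  ; tail = lookup (# 0 ∷ # 0 ∷ # 0 ∷ # 0 ∷ # 1 ∷ # 1 ∷ # 2 ∷ # 2 ∷ [])
  ; head = lookup (# 1 ∷ # 1 ∷ # 2 ∷ # 3 ∷ # 2 ∷ # 3 ∷ # 3 ∷ # 3 ∷ [])
  }

pt : ℤ → ℤ → Point
pt x y = x / 1 , y / 1

bendList : Fin 8 → List Point
bendList = lookup
  ( []
  ∷ (pt (+ 0) -1ℤ ∷ pt (+ 4) -1ℤ ∷ [])
  ∷ (pt -1ℤ (+ 0) ∷ pt -1ℤ (+ 4) ∷ [])
  ∷ (pt (+ 0) (+ 2) ∷ [])
  ∷ (pt (+ 5) (+ 0) ∷ pt (+ 5) (+ 5) ∷ pt (+ 2) (+ 5) ∷ [])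
  ∷ (pt (+ 4) (+ 1) ∷ pt (+ 2) (+ 1) ∷ [])
  ∷ []
  ∷ (pt (+ 3) (+ 4) ∷ pt (+ 3) (+ 2) ∷ [])
  ∷ [])

drawing : Drawing graph
drawing = record
  { pos = lookup (pt (+ 0) (+ 0) ∷ pt (+ 4) (+ 0) ∷ pt (+ 2) (+ 4) ∷ pt (+ 2) (+ 2) ∷ [])
  ; nbends = List.length ∘ bendList
  ; bends = Vec.fromList ∘ bendList
  }

planar : Planar graph
planar = drawing , boxCertified⇒isEmbedding drawing (from-yes (boxCertified? drawing))

open Trails graph

arcsOfList : List⁺ Arc → Arcs graph
arcsOfList (a ∷ as) = arcsOf (List.lookup (a ∷ as))

representatives : Vec (List⁺ Arc) 19
representatives =
  (# 6 ⁺ ∷ # 7 ⁻ ∷ []) ∷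
  (# 4 ⁺ ∷ # 7 ⁺ ∷ # 5 ⁻ ∷ []) ∷
  (# 4 ⁺ ∷ # 6 ⁺ ∷ # 5 ⁻ ∷ []) ∷
  (# 2 ⁻ ∷ # 3 ⁺ ∷ # 5 ⁻ ∷ # 4 ⁺ ∷ []) ∷
  (# 2 ⁻ ∷ # 3 ⁺ ∷ # 7 ⁻ ∷ []) ∷
  (# 2 ⁻ ∷ # 3 ⁺ ∷ # 6 ⁻ ∷ []) ∷
  (# 1 ⁺ ∷ # 5 ⁺ ∷ # 6 ⁻ ∷ # 2 ⁻ ∷ []) ∷
  (# 1 ⁺ ∷ # 5 ⁺ ∷ # 7 ⁻ ∷ # 2 ⁻ ∷ []) ∷
  (# 1 ⁺ ∷ # 4 ⁺ ∷ # 2 ⁻ ∷ []) ∷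
  (# 1 ⁻ ∷ # 3 ⁺ ∷ # 5 ⁻ ∷ []) ∷
  (# 1 ⁻ ∷ # 3 ⁺ ∷ # 7 ⁻ ∷ # 4 ⁻ ∷ []) ∷
  (# 1 ⁺ ∷ # 4 ⁺ ∷ # 6 ⁺ ∷ # 3 ⁻ ∷ []) ∷
  (# 0 ⁻ ∷ # 1 ⁺ ∷ []) ∷
  (# 0 ⁻ ∷ # 2 ⁺ ∷ # 6 ⁺ ∷ # 5 ⁻ ∷ []) ∷
  (# 0 ⁻ ∷ # 2 ⁺ ∷ # 7 ⁺ ∷ # 5 ⁻ ∷ []) ∷
  (# 0 ⁺ ∷ # 4 ⁺ ∷ # 2 ⁻ ∷ []) ∷
  (# 0 ⁻ ∷ # 3 ⁺ ∷ # 5 ⁻ ∷ []) ∷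
  (# 0 ⁻ ∷ # 3 ⁺ ∷ # 7 ⁻ ∷ # 4 ⁻ ∷ []) ∷
  (# 0 ⁺ ∷ # 4 ⁺ ∷ # 6 ⁺ ∷ # 3 ⁻ ∷ []) ∷
  []

trail : Fin 19 → Arcs graph
trail i = arcsOfList (lookup representatives i)

rep : Fin 19 → Vec ℤ 8
rep i = vec (trail i)

open RepresentativeSignature graph rep

rep-cycle : ∀ i → IsDirCycle graph (rep i)
rep-cycle i = trail i , from-yes (all? (isSimpleCycle? ∘ trail)) i , refl

rep-no-reversal : ∀ i j → rep j ≢ negV (rep i)
rep-no-reversal = from-yes (all? λ i → all? λ j → ¬? (≡-dec ℤ._≟_ (rep j) (negV (rep i))))

signed : ∀ d → IsDirCycle graph d → Signed d
signed = closedTrails⇒dirCycles (from-yes (ℕ.allUpTo? (closedTrailsSatisfy? signed?) 4))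

open Transversal rep-cycle rep-no-reversal signed

signature-triangulating : Triangulating graph signature
signature-triangulating = triangulating (from-no reversedRepresentativeInBasis?)

-- Representatives 6, 10, 14 and 18 are the four Hamiltonian cycles.
signature-not-acyclic : ¬ Acyclic graph signature
signature-not-acyclic acyclic = Any¬⇒¬All (here λ ()) (acyclic relation chosen refl)
  where
  relation : List (ℚ × Vec ℤ 8)
  relation = (1ℚ , rep (# 6)) ∷ (1ℚ , rep (# 10)) ∷ (1ℚ , rep (# 14)) ∷ (1ℚ , rep (# 18)) ∷ []
  chosen : All (λ (a , d) → CycleSignature.σ signature d × 0ℚ ≤ a) relation
  chosen = ((# 6 , refl) , 0≤1) ∷ ((# 10 , refl) , 0≤1) ∷ ((# 14 , refl) , 0≤1) ∷ ((# 18 , refl) , 0≤1) ∷ []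
    where
    0≤1 : 0ℚ ≤ 1ℚ
    0≤1 = from-yes (0ℚ ≤? 1ℚ)

proposition3p13 : Σ Graph λ G → Planar G ×
    Σ (CycleSignature G) λ S → Triangulating G S × ¬ Acyclic G S
proposition3p13 = graph , planar , signature , signature-triangulating , signature-not-acyclic
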